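{- Let $k\ge 1$ and let $S=(s_1,s_2,\ldots)$ be a packing sequence with $s_1=k$. Then every diameter $k$-critical graph is $\chi_S$-critical.
   Context: All graphs are finite and simple. A packing sequence is an infinite non-decreasing sequence $S=(s_1,s_2,\ldots)$ of positive integers. A map $c:V(G)\to\{1,\ldots,m\}$ is an $S$-packing $m$-coloring if for distinct $u,v$, $c(u)=c(v)=i$ implies $d_G(u,v)>s_i$; $\chi_S(G)$ is the least such $m$. $G$ is $\chi_S$-critical if $\chi_S(H)<\chi_S(G)$ for every proper (nonempty) subgraph $H$ of $G$. A graph $G$ is diameter $k$-critical if $\mathrm{diam}(G)=k$ and $\mathrm{diam}(G-e)>\mathrm{diam}(G)$ for every $e\in E(G)$ (diameter of a disconnected graph being infinite). -}

module Defs where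

open import Data.Nat using (ℕ; zero; suc; _≤_; _<_)
open import Data.Fin using (Fin; toℕ)
open import Data.Product using (Σ; _×_; ∃-syntax)
open import Data.Empty using (⊥)
open import Data.Sum using (_⊎_)
open import Relation.Nullary using (¬_; Dec)
open import Relation.Binary.PropositionalEquality using (_≡_; _≢_)
open import Function.Definitions using (Injective; Surjective)

record Graph : Set₁ where
  field
    n     : ℕ
    Adj   : Fin n → Fin n → Set
    dec   : ∀ u v → Dec (Adj u v)
    sym   : ∀ {u v} → Adj u v → Adj v u
    irrefl : ∀ {u} → ¬ Adj u u
open Graph public

data Walk {n : ℕ} (R : Fin n → Fin n → Set) : Fin n → Fin n → ℕ → Set where
  stay : ∀ {u} → Walk R u u zero
  step : ∀ {u v w ℓ} → R u v → Walk R v w ℓ → Walk R u w (suc ℓ)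

-- d_R(u,v) ≤ d  (distance is infinite when there is no walk)
DistLe : {n : ℕ} → (Fin n → Fin n → Set) → Fin n → Fin n → ℕ → Set
DistLe R u v d = ∃[ ℓ ] (ℓ ≤ d × Walk R u v ℓ)

DistEq : {n : ℕ} → (Fin n → Fin n → Set) → Fin n → Fin n → ℕ → Set
DistEq R u v d = DistLe R u v d × (∀ d' → d' < d → ¬ DistLe R u v d')

HasDiam : {n : ℕ} → (Fin n → Fin n → Set) → ℕ → Set
HasDiam {n} R k = (∀ u v → DistLe R u v k) × Σ (Fin n) (λ u → Σ (Fin n) (λ v → DistEq R u v k))

-- diam > k (including the disconnected case, diameter ∞).
DiamGt : {n : ℕ} → (Fin n → Fin n → Set) → ℕ → Set
DiamGt {n} R k = Σ (Fin n) (λ u → Σ (Fin n) (λ v → ¬ DistLe R u v k))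

DelEdge : (G : Graph) → Fin (n G) → Fin (n G) → Fin (n G) → Fin (n G) → Set
DelEdge G a b u v = Adj G u v × ¬ ((u ≡ a × v ≡ b) ⊎ (u ≡ b × v ≡ a))

DiamCritical : Graph → ℕ → Set
DiamCritical G k = HasDiam (Adj G) k × (∀ a b → Adj G a b → DiamGt (DelEdge G a b) k)

-- Packing sequence s_1, s_2, ... (index 0 unused): positive, non-decreasing.
record PackingSeq : Set where
  field
    s    : ℕ → ℕ
    pos  : ∀ i → 1 ≤ i → 1 ≤ s i
    mono : ∀ i j → 1 ≤ i → i ≤ j → s i ≤ s j
open PackingSeq public

-- S-packing m-coloring: color c u ∈ Fin m stands for color toℕ (c u) + 1.
IsPackingColoring : PackingSeq → (G : Graph) → (m : ℕ) → (Fin (n G) → Fin m) → Set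
IsPackingColoring S G m c =
  ∀ u v → u ≢ v → c u ≡ c v → ¬ DistLe (Adj G) u v (s S (suc (toℕ (c u))))

HasPackingColoring : PackingSeq → Graph → ℕ → Set
HasPackingColoring S G m = Σ (Fin (n G) → Fin m) (IsPackingColoring S G m)

ChiS : PackingSeq → Graph → ℕ → Set
ChiS S G m = HasPackingColoring S G m × (∀ m' → m' < m → ¬ HasPackingColoring S G m')

record Subgraph (G : Graph) : Set₁ where
  field
    H      : Graph
    emb    : Fin (n H) → Fin (n G)
    inj    : Injective _≡_ _≡_ emb
    edges  : ∀ {u v} → Adj H u v → Adj G (emb u) (emb v)
open Subgraph public

-- H is a proper subgraph: it is not all of G (misses a vertex or an edge).
Proper : {G : Graph} → Subgraph G → Set
Proper {G} P = ¬ (Surjective _≡_ _≡_ (emb P) ×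
                  (∀ u v → Adj G (emb P u) (emb P v) → Adj (H P) u v))

Nonempty : {G : Graph} → Subgraph G → Set
Nonempty P = 1 ≤ n (H P)

ChiSCritical : PackingSeq → Graph → Set₁
ChiSCritical S G = ∀ (P : Subgraph G) → Proper P → Nonempty P →
                   ∀ a b → ChiS S (H P) a → ChiS S G b → a < b

-- If diam G = s₁, any two vertices of G are within distance s₁ ≤ sᵢ, so every S-packing
-- colouring of G is injective and χ_S(G) ≥ |V(G)|.  A proper subgraph H of G either misses
-- a vertex, and then the injective colouring gives χ_S(H) ≤ |V(H)| < |V(G)|, or spans G and
-- misses an edge uv.  In the latter case criticality yields vertices p, q at distance > s₁
-- in G − uv ⊇ H, so p and q may share colour 1 while all other vertices get their own colour,
-- and χ_S(H) ≤ |V(H)| − 1 < |V(G)|.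
module Submission where

open import Defs
open import Data.Nat using (ℕ; zero; suc; pred; _≤_; _<_; z≤n; s≤s; _<?_)
open import Data.Nat.Properties using (≤-trans; <-≤-trans; ≮⇒≥; n<1+n; module ≤-Reasoning)
open import Data.Fin using (Fin; toℕ; punchOut; _≟_)
open import Data.Fin.Properties using (punchOut-injective; suc-injective; injective⇒≤; any?)
open import Data.Product using (Σ; _×_; _,_; ∃-syntax)
open import Data.Sum using (_⊎_; inj₁; inj₂)
open import Data.Empty using (⊥-elim)
open import Relation.Nullary using (¬_; yes; no)
open import Relation.Binary.PropositionalEquality
  using (_≡_; _≢_; refl; trans; cong; subst; subst₂)
  renaming (sym to ≡-sym)
open import Function using (_∘_)
open import Function.Definitions using (Injective; Surjective)

private
  variable
    N M : ℕ
    R : Fin N → Fin N → Set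
    R′ : Fin M → Fin M → Set

Walk-map : (f : Fin N → Fin M) → (∀ {u v} → R u v → R′ (f u) (f v)) →
           ∀ {u v ℓ} → Walk R u v ℓ → Walk R′ (f u) (f v) ℓ
Walk-map f hom stay       = stay
Walk-map f hom (step r w) = step (hom r) (Walk-map f hom w)

Walk-snoc : ∀ {u v w ℓ} → Walk R u v ℓ → R v w → Walk R u w (suc ℓ)
Walk-snoc stay        r = step r stay
Walk-snoc (step r′ w) r = step r′ (Walk-snoc w r)

Walk-reverse : (∀ {u v} → R u v → R v u) → ∀ {u v ℓ} → Walk R u v ℓ → Walk R v u ℓ
Walk-reverse sym stay       = stay
Walk-reverse sym (step r w) = Walk-snoc (Walk-reverse sym w) (sym r)

DistLe-map : (f : Fin N → Fin M) → (∀ {u v} → R u v → R′ (f u) (f v)) →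
             ∀ {u v d} → DistLe R u v d → DistLe R′ (f u) (f v) d
DistLe-map f hom (ℓ , ℓ≤d , w) = ℓ , ℓ≤d , Walk-map f hom w

DistLe-sym : (∀ {u v} → R u v → R v u) → ∀ {u v d} → DistLe R u v d → DistLe R v u d
DistLe-sym sym (ℓ , ℓ≤d , w) = ℓ , ℓ≤d , Walk-reverse sym w

DistLe-weaken : ∀ {u v d d′} → d ≤ d′ → DistLe R u v d → DistLe R u v d′
DistLe-weaken d≤d′ (ℓ , ℓ≤d , w) = ℓ , ≤-trans ℓ≤d d≤d′ , w

DistLe-refl : ∀ {u d} → DistLe R u u d
DistLe-refl = 0 , z≤n , stay

injective∧¬surjective⇒< : {f : Fin M → Fin N} → Injective _≡_ _≡_ f →
                          (y : Fin N) → (∀ x → f x ≢ y) → M < N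
injective∧¬surjective⇒< {N = suc _} {f = f} f-inj y missed =
  s≤s (injective⇒≤ {f = λ x → punchOut (y≢f x)}
         (λ eq → f-inj (punchOut-injective (y≢f _) (y≢f _) eq)))
  where
  y≢f : ∀ x → y ≢ f x
  y≢f x eq = missed x (≡-sym eq)

pred[n]<n : ∀ {n} → 1 ≤ n → pred n < n
pred[n]<n {suc n} _ = n<1+n n

UnorderedPair : {A : Set} → A → A → A → A → Set
UnorderedPair p q u v = (u ≡ p × v ≡ q) ⊎ (u ≡ q × v ≡ p)

module Merge {m : ℕ} {p q : Fin (suc (suc m))} (p≢q : p ≢ q) where

  merge : Fin (suc (suc m)) → Fin (suc m)
  merge u with p ≟ u
  ... | yes _ = Fin.zero
  ... | no p≢u with punchOut p≢q ≟ punchOut p≢u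
  ...   | yes _ = Fin.zero
  ...   | no q′≢u′ = Fin.suc (punchOut q′≢u′)

  merge-zero : ∀ u → merge u ≡ Fin.zero → u ≡ p ⊎ u ≡ q
  merge-zero u eq with p ≟ u
  ... | yes p≡u = inj₁ (≡-sym p≡u)
  ... | no p≢u with punchOut p≢q ≟ punchOut p≢u
  ...   | yes q′≡u′ = inj₂ (≡-sym (punchOut-injective p≢q p≢u q′≡u′))
  merge-zero u () | no _ | no _

  merge-suc-injective : ∀ u v → merge u ≡ merge v → merge u ≢ Fin.zero → u ≡ v
  merge-suc-injective u v eq nz with p ≟ u
  ... | yes _ = ⊥-elim (nz refl)
  ... | no p≢u with punchOut p≢q ≟ punchOut p≢u
  ...   | yes _ = ⊥-elim (nz refl)
  ...   | no q′≢u′ with p ≟ v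
  merge-suc-injective u v () nz | no _ | no _ | yes _
  ... | no p≢v with punchOut p≢q ≟ punchOut p≢v
  merge-suc-injective u v () nz | no _ | no _ | no _ | yes _
  ... | no q′≢v′ =
    punchOut-injective p≢u p≢v (punchOut-injective q′≢u′ q′≢v′ (suc-injective eq))

  merge-collision : ∀ u v → u ≢ v → merge u ≡ merge v →
                    merge u ≡ Fin.zero × UnorderedPair p q u v
  merge-collision u v u≢v eq with merge u ≟ Fin.zero
  ... | no nz = ⊥-elim (u≢v (merge-suc-injective u v eq nz))
  ... | yes z with merge-zero u z | merge-zero v (trans (≡-sym eq) z)
  ... | inj₁ u≡p | inj₁ v≡p = ⊥-elim (u≢v (trans u≡p (≡-sym v≡p)))
  ... | inj₁ u≡p | inj₂ v≡q = z , inj₁ (u≡p , v≡q)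
  ... | inj₂ u≡q | inj₁ v≡p = z , inj₂ (u≡q , v≡p)
  ... | inj₂ u≡q | inj₂ v≡q = ⊥-elim (u≢v (trans u≡q (≡-sym v≡q)))

merge-into-pred : {p q : Fin N} → p ≢ q →
                  Σ (Fin N → Fin (pred N)) λ f →
                    ∀ u v → u ≢ v → f u ≡ f v → toℕ (f u) ≡ 0 × UnorderedPair p q u v
merge-into-pred {suc zero}    {Fin.zero} {Fin.zero} p≢q = ⊥-elim (p≢q refl)
merge-into-pred {suc (suc m)}                       p≢q = merge , collision
  where
  open Merge p≢q
  collision : ∀ u v → u ≢ v → merge u ≡ merge v → toℕ (merge u) ≡ 0 × UnorderedPair _ _ u v
  collision u v u≢v eq with merge-collision u v u≢v eq
  ... | z , pair = cong toℕ z , pair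

module _ (S : PackingSeq) where

  s₁≤s : ∀ i → s S 1 ≤ s S (suc i)
  s₁≤s i = mono S 1 (suc i) (s≤s z≤n) (s≤s z≤n)

  identity-colouring : (G : Graph) → HasPackingColoring S G (n G)
  identity-colouring G = (λ u → u) , λ u v u≢v u≡v → ⊥-elim (u≢v u≡v)

  -- Only p and q share a colour, and it is colour 1, whose packing distance s₁ they exceed.
  far-pair-colouring : (G : Graph) {p q : Fin (n G)} → p ≢ q →
                       ¬ DistLe (Adj G) p q (s S 1) → HasPackingColoring S G (pred (n G))
  far-pair-colouring G p≢q far with merge-into-pred p≢q
  ... | c , collision = c , valid
    where
    valid : IsPackingColoring S G _ c
    valid u v u≢v cu≡cv close with collision u v u≢v cu≡cv
    ... | cu≡0 , pair = apart pair (subst (λ i → DistLe (Adj G) u v (s S (suc i))) cu≡0 close)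
      where
      apart : UnorderedPair _ _ u v → ¬ DistLe (Adj G) u v (s S 1)
      apart (inj₁ (refl , refl)) = far
      apart (inj₂ (refl , refl)) = far ∘ DistLe-sym (Graph.sym G)

  packing-colouring-injective : (G : Graph) → (∀ u v → DistLe (Adj G) u v (s S 1)) →
                                ∀ {m c} → IsPackingColoring S G m c → Injective _≡_ _≡_ c
  packing-colouring-injective G close valid {u} {v} cu≡cv with u ≟ v
  ... | yes u≡v = u≡v
  ... | no u≢v  = ⊥-elim (valid u v u≢v cu≡cv (DistLe-weaken (s₁≤s _) (close u v)))

  ChiS-minimal : ∀ G {a m} → ChiS S G a → HasPackingColoring S G m → a ≤ m
  ChiS-minimal G (_ , minimal) colouring = ≮⇒≥ (λ m<a → minimal _ m<a colouring)

  n≤ChiS : ∀ G {b} → (∀ u v → DistLe (Adj G) u v (s S 1)) → ChiS S G b → n G ≤ b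
  n≤ChiS G close ((c , valid) , _) = injective⇒≤ (packing-colouring-injective G close valid)

subgraph-avoids-missing-edge : {G : Graph} (P : Subgraph G) → ∀ {u v} → ¬ Adj (H P) u v →
  ∀ {x y} → Adj (H P) x y → DelEdge G (emb P u) (emb P v) (emb P x) (emb P y)
subgraph-avoids-missing-edge P ¬uv xy = edges P xy , λ
  { (inj₁ (x≡u , y≡v)) → ¬uv (subst₂ (Adj (H P)) (inj P x≡u) (inj P y≡v) xy)
  ; (inj₂ (x≡v , y≡u)) → ¬uv (Graph.sym (H P) (subst₂ (Adj (H P)) (inj P x≡v) (inj P y≡u) xy)) }

module _ (S : PackingSeq) {G : Graph}
         (edge-critical : ∀ a b → Adj G a b → DiamGt (DelEdge G a b) (s S 1)) where

  -- Double-negated because Proper is itself a negation: we refute both ways of being non-proper.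
  proper-subgraph-fewer-colours : (P : Subgraph G) → Proper P → Nonempty P →
    ¬ ¬ (∃[ m ] (HasPackingColoring S (H P) m × m < n G))
  proper-subgraph-fewer-colours P proper nonempty none = proper (covers , spans)
    where
    e : Fin (n (H P)) → Fin (n G)
    e = emb P
    covers : Surjective _≡_ _≡_ e
    covers y with any? (λ x → e x ≟ y)
    ... | yes (x , ex≡y) = x , λ { refl → ex≡y }
    ... | no missed = ⊥-elim (none (n (H P) , identity-colouring S (H P) ,
                        injective∧¬surjective⇒< (inj P) y (λ x ex≡y → missed (x , ex≡y))))
    preimage : ∀ y → ∃[ x ] e x ≡ y
    preimage y with covers y
    ... | x , ex≡y = x , ex≡y refl
    spans : ∀ u v → Adj G (e u) (e v) → Adj (H P) u v
    spans u v uv with dec (H P) u v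
    ... | yes huv = huv
    ... | no ¬huv with edge-critical (e u) (e v) uv
    ...   | p , q , far with preimage p | preimage q
    ...     | p′ , refl | q′ , refl = ⊥-elim (none (pred (n (H P)) ,
                                far-pair-colouring S (H P) p′≢q′ farH ,
                                <-≤-trans (pred[n]<n nonempty) (injective⇒≤ (inj P))))
      where
      farH : ¬ DistLe (Adj (H P)) p′ q′ (s S 1)
      farH = far ∘ DistLe-map e (subgraph-avoids-missing-edge P ¬huv)
      p′≢q′ : p′ ≢ q′
      p′≢q′ refl = farH DistLe-refl

proposition3p3 : (k : ℕ) → 1 ≤ k → (S : PackingSeq) → s S 1 ≡ k →
    (G : Graph) → DiamCritical G k → ChiSCritical S G
proposition3p3 .(s S 1) _ S refl G ((close , _) , edge-critical) P proper nonempty a b χH χG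
  with a <? b
... | yes a<b = a<b
... | no a≮b = ⊥-elim (proper-subgraph-fewer-colours S edge-critical P proper nonempty
  λ (m , colouring , m<nG) → a≮b (begin-strict
    a    ≤⟨ ChiS-minimal S (H P) χH colouring ⟩
    m    <⟨ m<nG ⟩
    n G  ≤⟨ n≤ChiS S G close χG ⟩
    b    ∎))
  where open ≤-Reasoning
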